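{- Let $m\ge1$ and $a,b\in\{0,1\}^{m+1}$. The following are equivalent: (a) for every $n\ge1$, the equivalence relations $\sim_a$ and $\sim_b$ on $\{0,1\}^n$ have the same number of equivalence classes of size $1$; (b) for every $i\in\{1,\dots,m+1\}$, $$a_{[1,i]}\in\{a_{[m+2-i,\,m+1]},\ \neg a_{[m+2-i,\,m+1]}\}\iff b_{[1,i]}\in\{b_{[m+2-i,\,m+1]},\ \neg b_{[m+2-i,\,m+1]}\}.$$
   Context: Binary words are elements of $\{0,1\}^n$; $\neg$ flips every letter; $u_{[i,j]}=(u_i,\dots,u_j)$. For a keyword $a\in\{0,1\}^{m+1}$ and $i\in\{1,\dots,n\}$, the simple map $\varphi_i^{(a)}:\{0,1\}^n\to\{0,1\}^n$ negates the letters of $u$ in positions $i,\dots,i+m$ if $i+m\le n$ and $u_{[i,i+m]}\in\{a,\neg a\}$, and otherwise returns $u$. On $\{0,1\}^n$, $u\sim_a v$ means there exist indices $i_1,\dots,i_r$ ($r\ge0$) with $(\varphi_{i_r}^{(a)}\circ\cdots\circ\varphi_{i_1}^{(a)})(u)=v$; this is an equivalence relation. -}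

module Defs where

open import Data.Bool using (Bool; true; false; not; if_then_else_; _∧_; _∨_)
open import Data.Nat using (ℕ; zero; suc; _+_; _∸_; _≤_; _≤ᵇ_; _<ᵇ_)
open import Data.Fin using (Fin; toℕ)
open import Data.List using (List; take; drop; map; length)
open import Data.List.Properties using (≡-dec)
open import Data.List.Membership.Propositional using (_∈_)
open import Data.List.Relation.Unary.Unique.Propositional using (Unique)
open import Data.Vec using (Vec; toList; tabulate; lookup)
open import Data.Product using (Σ; _×_)
open import Data.Sum using (_⊎_)
open import Function.Bundles using (_⇔_)
open import Relation.Binary.PropositionalEquality using (_≡_)
open import Relation.Binary.Construct.Closure.ReflexiveTransitive using (Star)
open import Relation.Nullary.Decidable using (⌊_⌋)
import Data.Bool.Properties as BoolP

-- Binary words of length n are  Vec Bool n  (false = 0, true = 1).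

_==_ : List Bool → List Bool → Bool
xs == ys = ⌊ ≡-dec BoolP._≟_ xs ys ⌋

-- The factor u_[i+1, i+k] (0-based start i, length k), as a list.
window : {n : ℕ} → ℕ → ℕ → Vec Bool n → List Bool
window i k u = take k (drop i (toList u))

flipRange : {n : ℕ} → ℕ → ℕ → Vec Bool n → Vec Bool n
flipRange i k u =
  tabulate λ j → if (i ≤ᵇ toℕ j) ∧ (toℕ j <ᵇ i + k) then not (lookup u j) else lookup u j

-- The simple map φ_i^(a) for a keyword a ∈ {0,1}^(m+1), with 1-based index i:
-- negates positions i..i+m if 1 ≤ i, i+m ≤ n and u_[i,i+m] ∈ {a, ¬a}; else identity.
φ : {m n : ℕ} → Vec Bool (suc m) → ℕ → Vec Bool n → Vec Bool n
φ {m} {n} a zero u = u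
φ {m} {n} a (suc i′) u =
  if (suc i′ + m ≤ᵇ n)
     ∧ ((window i′ (suc m) u == toList a)
        ∨ (window i′ (suc m) u == map not (toList a)))
  then flipRange i′ (suc m) u
  else u

Step : {m n : ℕ} → Vec Bool (suc m) → Vec Bool n → Vec Bool n → Set
Step {m} {n} a u v = Σ ℕ λ i → (1 ≤ i) × (i ≤ n) × (φ a i u ≡ v)

_∼[_]_ : {m n : ℕ} → Vec Bool n → Vec Bool (suc m) → Vec Bool n → Set
u ∼[ a ] v = Star (Step a) u v

SingletonClass : {m n : ℕ} → Vec Bool (suc m) → Vec Bool n → Set
SingletonClass a u = ∀ v → u ∼[ a ] v → v ≡ u

-- The number of ∼_a-classes of size 1 on {0,1}^n equals k:
-- there is a duplicate-free list of length k whose members are exactly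
-- the words whose class is a singleton (one word per such class).
SingletonClassCount : {m : ℕ} → Vec Bool (suc m) → (n : ℕ) → ℕ → Set
SingletonClassCount a n k =
  Σ (List (Vec Bool n)) λ xs →
    Unique xs × (∀ u → (u ∈ xs) ⇔ SingletonClass a u) × (length xs ≡ k)

Border : {m : ℕ} → Vec Bool (suc m) → ℕ → Set
Border {m} a i =
  (take i (toList a) ≡ drop (suc m ∸ i) (toList a))
  ⊎ (take i (toList a) ≡ map not (drop (suc m ∸ i) (toList a)))

-- A word is alone in its ∼_a-class iff no simple map moves it, i.e. iff neither a nor ¬a occurs
-- in it.  Let f n count such words of length n, and g n the words of length n that begin with an
-- occurrence of a or ¬a and contain no other one.  Deleting the first letter of a word gives
-- f (n+1) + g (n+1) = 2 f n.  A word "occurrence · avoiding word of length n" has a last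
-- occurrence, starting at a shift p ≤ m at which a overlaps itself up to negation; hence
-- 2 f n = Σ_{p ≤ m} c p · g (m+1-p+n), where c p = 1 iff a_[p+1,m+1] is a_[1,m+1-p] or its
-- negation, i.e. condition (b) for i = m+1-p.  As g vanishes below m+1 and g (m+1) > 0, the two
-- recurrences make (f n)_n and (c p)_{p ≤ m} determine each other.

module Submission where

open import Defs

open import Data.Bool using (Bool; true; false; not; _∧_; _∨_; T; if_then_else_)
open import Data.Bool.Properties
  using (∧-zeroʳ; ∧-conicalˡ; ∧-conicalʳ; ∨-comm; not-¬; not-involutive; not-injective; T-≡; T-∨)
  renaming (_≟_ to _≟ᵇ_)
open import Data.Empty using (⊥-elim)
open import Data.Fin using (Fin; toℕ; fromℕ<)
open import Data.Fin.Properties using (toℕ-fromℕ<)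
open import Data.List using (List; []; _∷_; _++_; take; drop; map; length; filter)
open import Data.List.Membership.Propositional using (_∈_)
open import Data.List.Membership.Propositional.Properties
  using (∈-map⁺; ∈-map⁻; ∈-++⁺ˡ; ∈-++⁺ʳ; ∈-filter⁺; ∈-filter⁻)
open import Data.List.Membership.Propositional.Properties.WithK using (unique∧set⇒bag)
open import Data.List.Properties
  using (≡-dec; ∷-injectiveʳ; map-injective; length-map; length-take; length-drop;
         take-all; drop-all; take-map; drop-map; take-take; drop-drop; ++-identityʳ; map-++; map-∘)
open import Data.List.Relation.Binary.BagAndSetEquality using (∼bag⇒↭)
open import Data.List.Relation.Binary.Permutation.Propositional.Properties using (↭-length)
open import Data.List.Relation.Unary.All using ([])
open import Data.List.Relation.Unary.AllPairs using ([]; _∷_)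
open import Data.List.Relation.Unary.Any using (here)
open import Data.List.Relation.Unary.Unique.Propositional using (Unique)
import Data.List.Relation.Unary.Unique.Propositional.Properties as Unique
open import Data.Nat
open import Data.Nat.Induction using (<-rec)
open import Data.Nat.ListAction using (sum)
open import Data.Nat.ListAction.Properties using (sum-++)
open import Data.Nat.Properties
open import Algebra.Properties.CommutativeSemigroup +-commutativeSemigroup using (interchange)
open import Data.Product using (_×_; _,_; proj₁; proj₂)
open import Data.Sum using (_⊎_; inj₁; inj₂)
import Data.Sum as Sum
open import Data.Vec using (Vec; toList; lookup) renaming ([] to []ᵛ; _∷_ to _∷ᵛ_)
open import Data.Vec.Properties using (lookup∘tabulate; length-toList)
import Data.Vec.Properties as Vec
open import Function using (_∘_; const)
open import Function.Bundles using (_⇔_; mk⇔; Equivalence)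
open import Function.Construct.Symmetry using (⇔-sym)
open import Function.Properties.Equivalence using (⇔-setoid)
open import Level using (0ℓ)
open import Relation.Binary.Construct.Closure.ReflexiveTransitive using (Star; ε; _◅_)
open import Relation.Binary.Definitions using (tri<; tri≈; tri>)
open import Relation.Binary.PropositionalEquality
import Relation.Binary.Reasoning.Setoid as SetoidReasoning
open import Relation.Nullary using (¬_; Dec; yes; no; contradiction)
open import Relation.Nullary.Decidable using (isYes≗does; does-⇔; toWitness; fromWitness; dec-false)

open Equivalence using (to; from)

𝟙 : Bool → ℕ
𝟙 true = 1
𝟙 false = 0

𝟙-∨ : ∀ b c → b ∧ c ≡ false → 𝟙 (b ∨ c) ≡ 𝟙 b + 𝟙 c
𝟙-∨ true  false _ = refl
𝟙-∨ false c     _ = refl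

𝟙-split : ∀ b c → 𝟙 c ≡ 𝟙 (not b ∧ c) + 𝟙 (b ∧ c)
𝟙-split true  c = refl
𝟙-split false c = sym (+-identityʳ (𝟙 c))

𝟙-≡⇔ : ∀ {X Y : Set} b c → X ⇔ T b → Y ⇔ T c → (X ⇔ Y) ⇔ (𝟙 b ≡ 𝟙 c)
𝟙-≡⇔ true  true  X⇔ Y⇔ = mk⇔ (const refl) (const (mk⇔ (const (from Y⇔ _)) (const (from X⇔ _))))
𝟙-≡⇔ true  false X⇔ Y⇔ = mk⇔ (λ X⇔Y → ⊥-elim (to Y⇔ (to X⇔Y (from X⇔ _)))) λ ()
𝟙-≡⇔ false true  X⇔ Y⇔ = mk⇔ (λ X⇔Y → ⊥-elim (to X⇔ (from X⇔Y (from Y⇔ _)))) λ ()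
𝟙-≡⇔ false false X⇔ Y⇔ = mk⇔ (const refl) (const (mk⇔ (⊥-elim ∘ to X⇔) (⊥-elim ∘ to Y⇔)))

𝟙-guard : ∀ {x y} b → (b ≡ true → x ≡ y) → x * 𝟙 b ≡ y * 𝟙 b
𝟙-guard         true  x≡y = cong (_* 1) (x≡y refl)
𝟙-guard {x} {y} false _   = trans (*-zeroʳ x) (sym (*-zeroʳ y))

take-++ : ∀ {A : Set} (u v : List A) k → take (length u + k) (u ++ v) ≡ u ++ take k v
take-++ []      v k = refl
take-++ (x ∷ u) v k = cong (x ∷_) (take-++ u v k)

drop-++ : ∀ {A : Set} (u v : List A) → drop (length u) (u ++ v) ≡ v
drop-++ []      v = refl
drop-++ (x ∷ u) v = drop-++ u v

==-cong : ∀ {xs ys xs′ ys′} → (xs ≡ ys ⇔ xs′ ≡ ys′) → (xs == ys) ≡ (xs′ == ys′)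
==-cong {xs} {ys} {xs′} {ys′} e =
  trans (isYes≗does (≡-dec _≟ᵇ_ xs ys))
        (trans (does-⇔ e (≡-dec _≟ᵇ_ xs ys) (≡-dec _≟ᵇ_ xs′ ys′))
               (sym (isYes≗does (≡-dec _≟ᵇ_ xs′ ys′))))

T-== : ∀ {xs ys} → T (xs == ys) ⇔ xs ≡ ys
T-== = mk⇔ toWitness fromWitness

==-refl : ∀ xs → (xs == xs) ≡ true
==-refl xs = to T-≡ (fromWitness refl)

==-false : ∀ {xs ys} → xs ≢ ys → (xs == ys) ≡ false
==-false {xs} {ys} ne = trans (isYes≗does (≡-dec _≟ᵇ_ xs ys)) (dec-false (≡-dec _≟ᵇ_ xs ys) ne)

==-sym : ∀ xs ys → (xs == ys) ≡ (ys == xs)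
==-sym xs ys = ==-cong (mk⇔ sym sym)

==-∷ : ∀ x xs ys → ((x ∷ xs) == (x ∷ ys)) ≡ (xs == ys)
==-∷ x xs ys = ==-cong (mk⇔ ∷-injectiveʳ (cong (x ∷_)))

map-not-involutive : ∀ xs → map not (map not xs) ≡ xs
map-not-involutive [] = refl
map-not-involutive (x ∷ xs) = cong₂ _∷_ (not-involutive x) (map-not-involutive xs)

==-map-not : ∀ xs ys → (map not xs == map not ys) ≡ (xs == ys)
==-map-not xs ys = ==-cong (mk⇔ (map-injective not-injective) (cong (map not)))

==-map-notˡ : ∀ xs ys → (map not xs == ys) ≡ (xs == map not ys)
==-map-notˡ xs ys = ==-cong (mk⇔ (λ e → trans (sym (map-not-involutive xs)) (cong (map not) e))
                                  (λ e → trans (cong (map not) e) (map-not-involutive ys)))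

_==±_ : List Bool → List Bool → Bool
xs ==± ys = (xs == ys) ∨ (xs == map not ys)

T-==± : ∀ {xs ys} → T (xs ==± ys) ⇔ (xs ≡ ys ⊎ xs ≡ map not ys)
T-==± = mk⇔ (Sum.map (to T-==) (to T-==) ∘ to T-∨) (from T-∨ ∘ Sum.map (from T-==) (from T-==))

≢-map-not : ∀ ys → 1 ≤ length ys → ys ≢ map not ys
≢-map-not (true  ∷ ys) _ ()
≢-map-not (false ∷ ys) _ ()

𝟙-==± : ∀ xs ys → 1 ≤ length ys → 𝟙 (xs ==± ys) ≡ 𝟙 (xs == ys) + 𝟙 (xs == map not ys)
𝟙-==± xs ys ys≢[] = 𝟙-∨ (xs == ys) (xs == map not ys) disjoint
  where
    disjoint : (xs == ys) ∧ (xs == map not ys) ≡ false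
    disjoint with xs == ys in xs=ys
    ... | false = refl
    ... | true rewrite toWitness (from T-≡ xs=ys) = ==-false (≢-map-not ys ys≢[])

==±-map-notˡ : ∀ xs ys → (map not xs ==± ys) ≡ (xs ==± ys)
==±-map-notˡ xs ys =
  trans (cong₂ _∨_ (==-map-notˡ xs ys) (==-map-not xs ys)) (∨-comm (xs == map not ys) (xs == ys))

wordSum : ℕ → (List Bool → ℕ) → ℕ
wordSum zero    h = h []
wordSum (suc n) h = wordSum n (λ w → h (false ∷ w)) + wordSum n (λ w → h (true ∷ w))

wordSum-cong : ∀ n {h h′ : List Bool → ℕ} → (∀ w → length w ≡ n → h w ≡ h′ w) →
               wordSum n h ≡ wordSum n h′
wordSum-cong zero    h≗h′ = h≗h′ [] refl
wordSum-cong (suc n) h≗h′ = cong₂ _+_ (wordSum-cong n (λ w ∣w∣ → h≗h′ (false ∷ w) (cong suc ∣w∣)))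
                                       (wordSum-cong n (λ w ∣w∣ → h≗h′ (true ∷ w) (cong suc ∣w∣)))

wordSum-zero : ∀ n → wordSum n (const 0) ≡ 0
wordSum-zero zero    = refl
wordSum-zero (suc n) = cong₂ _+_ (wordSum-zero n) (wordSum-zero n)

wordSum-+ : ∀ n (h h′ : List Bool → ℕ) → wordSum n (λ w → h w + h′ w) ≡ wordSum n h + wordSum n h′
wordSum-+ zero    h h′ = refl
wordSum-+ (suc n) h h′ =
  trans (cong₂ _+_ (wordSum-+ n (λ w → h (false ∷ w)) (λ w → h′ (false ∷ w)))
                   (wordSum-+ n (λ w → h (true ∷ w)) (λ w → h′ (true ∷ w))))
        (interchange (wordSum n (λ w → h (false ∷ w))) (wordSum n (λ w → h′ (false ∷ w)))
                     (wordSum n (λ w → h (true ∷ w))) (wordSum n (λ w → h′ (true ∷ w))))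

wordSum-*ˡ : ∀ n k (h : List Bool → ℕ) → wordSum n (λ w → k * h w) ≡ k * wordSum n h
wordSum-*ˡ zero    k h = refl
wordSum-*ˡ (suc n) k h =
  trans (cong₂ _+_ (wordSum-*ˡ n k (λ w → h (false ∷ w))) (wordSum-*ˡ n k (λ w → h (true ∷ w))))
        (sym (*-distribˡ-+ k _ _))

wordSum-*ʳ : ∀ n k (h : List Bool → ℕ) → wordSum n (λ w → h w * k) ≡ wordSum n h * k
wordSum-*ʳ n k h = trans (wordSum-cong n (λ w _ → *-comm (h w) k)) (trans (wordSum-*ˡ n k h) (*-comm k _))

wordSum-++ : ∀ p q (h : List Bool → ℕ) → wordSum (p + q) h ≡ wordSum p (λ u → wordSum q (λ v → h (u ++ v)))
wordSum-++ zero    q h = refl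
wordSum-++ (suc p) q h = cong₂ _+_ (wordSum-++ p q (λ w → h (false ∷ w))) (wordSum-++ p q (λ w → h (true ∷ w)))

wordSum-comm : ∀ p q (F : List Bool → List Bool → ℕ) →
               wordSum p (λ u → wordSum q (F u)) ≡ wordSum q (λ v → wordSum p (λ u → F u v))
wordSum-comm zero    q F = refl
wordSum-comm (suc p) q F =
  trans (cong₂ _+_ (wordSum-comm p q (λ u → F (false ∷ u))) (wordSum-comm p q (λ u → F (true ∷ u))))
        (sym (wordSum-+ q (λ v → wordSum p (λ u → F (false ∷ u) v))
                          (λ v → wordSum p (λ u → F (true ∷ u) v))))

wordSum-≥ : ∀ w (h : List Bool → ℕ) → h w ≤ wordSum (length w) h
wordSum-≥ []          h = ≤-refl
wordSum-≥ (false ∷ w) h = ≤-trans (wordSum-≥ w (λ v → h (false ∷ v))) (m≤m+n _ _)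
wordSum-≥ (true  ∷ w) h = ≤-trans (wordSum-≥ w (λ v → h (true ∷ v))) (m≤n+m _ _)

wordSum-prefix-== : ∀ p t X → length X ≡ p + length t →
                    wordSum p (λ u → 𝟙 ((u ++ t) == X)) ≡ 𝟙 (drop p X == t)
wordSum-prefix-== zero    t X           _     = cong 𝟙 (==-sym t X)
wordSum-prefix-== (suc p) t (false ∷ X) ∣X∣ =
  trans (cong₂ _+_ (trans (wordSum-cong p (λ u _ → cong 𝟙 (==-∷ false (u ++ t) X)))
                          (wordSum-prefix-== p t X (suc-injective ∣X∣)))
                   (wordSum-zero p))
        (+-identityʳ _)
wordSum-prefix-== (suc p) t (true ∷ X)  ∣X∣ =
  cong₂ _+_ (wordSum-zero p)
            (trans (wordSum-cong p (λ u _ → cong 𝟙 (==-∷ true (u ++ t) X)))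
                   (wordSum-prefix-== p t X (suc-injective ∣X∣)))

wordSum-== : ∀ n X → length X ≡ n → wordSum n (λ u → 𝟙 (u == X)) ≡ 1
wordSum-== n X ∣X∣ = begin
  wordSum n (λ u → 𝟙 (u == X))
    ≡⟨ wordSum-cong n (λ u _ → cong (λ w → 𝟙 (w == X)) (++-identityʳ u)) ⟨
  wordSum n (λ u → 𝟙 ((u ++ []) == X))
    ≡⟨ wordSum-prefix-== n [] X (trans ∣X∣ (sym (+-identityʳ n))) ⟩
  𝟙 (drop n X == [])
    ≡⟨ cong (λ w → 𝟙 (w == [])) (drop-all n X (≤-reflexive ∣X∣)) ⟩
  1 ∎
  where open ≡-Reasoning

wordSum-prefix-==± : ∀ p t X → length X ≡ p + length t → 1 ≤ length t →
                     wordSum p (λ u → 𝟙 ((u ++ t) ==± X)) ≡ 𝟙 (t ==± drop p X)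
wordSum-prefix-==± p t X ∣X∣ t≢[] = begin
  wordSum p (λ u → 𝟙 ((u ++ t) ==± X))
    ≡⟨ wordSum-cong p (λ u _ → 𝟙-==± (u ++ t) X X≢[]) ⟩
  wordSum p (λ u → 𝟙 ((u ++ t) == X) + 𝟙 ((u ++ t) == map not X))
    ≡⟨ wordSum-+ p (λ u → 𝟙 ((u ++ t) == X)) (λ u → 𝟙 ((u ++ t) == map not X)) ⟩
  wordSum p (λ u → 𝟙 ((u ++ t) == X)) + wordSum p (λ u → 𝟙 ((u ++ t) == map not X))
    ≡⟨ cong₂ _+_ (wordSum-prefix-== p t X ∣X∣)
                 (wordSum-prefix-== p t (map not X) (trans (length-map not X) ∣X∣)) ⟩
  𝟙 (drop p X == t) + 𝟙 (drop p (map not X) == t)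
    ≡⟨ cong₂ _+_ (cong 𝟙 (==-sym (drop p X) t))
                 (cong 𝟙 (trans (cong (_== t) (drop-map p X)) (==-sym (map not (drop p X)) t))) ⟩
  𝟙 (t == drop p X) + 𝟙 (t == map not (drop p X))
    ≡⟨ 𝟙-==± t (drop p X) dropX≢[] ⟨
  𝟙 (t ==± drop p X) ∎
  where
    open ≡-Reasoning
    X≢[] : 1 ≤ length X
    X≢[] = ≤-trans t≢[] (subst (length t ≤_) (sym ∣X∣) (m≤n+m (length t) p))
    dropX≢[] : 1 ≤ length (drop p X)
    dropX≢[] = subst (1 ≤_) (sym (trans (length-drop p X) (trans (cong (_∸ p) ∣X∣) (m+n∸m≡n p (length t)))))
                     t≢[]

sumTo : ℕ → (ℕ → ℕ) → ℕ
sumTo zero    h = 0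
sumTo (suc k) h = h 0 + sumTo k (λ p → h (suc p))

sumTo-cong : ∀ k {h h′ : ℕ → ℕ} → (∀ p → p < k → h p ≡ h′ p) → sumTo k h ≡ sumTo k h′
sumTo-cong zero    h≗h′ = refl
sumTo-cong (suc k) h≗h′ = cong₂ _+_ (h≗h′ 0 z<s) (sumTo-cong k (λ p p<k → h≗h′ (suc p) (s<s p<k)))

sumTo-*ˡ : ∀ k c (h : ℕ → ℕ) → c * sumTo k h ≡ sumTo k (λ p → c * h p)
sumTo-*ˡ zero    c h = *-zeroʳ c
sumTo-*ˡ (suc k) c h = trans (*-distribˡ-+ c (h 0) _) (cong (c * h 0 +_) (sumTo-*ˡ k c (λ p → h (suc p))))

wordSum-sumTo : ∀ n k (F : ℕ → List Bool → ℕ) →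
                wordSum n (λ w → sumTo k (λ p → F p w)) ≡ sumTo k (λ p → wordSum n (F p))
wordSum-sumTo n zero    F = wordSum-zero n
wordSum-sumTo n (suc k) F =
  trans (wordSum-+ n (F 0) (λ w → sumTo k (λ p → F (suc p) w)))
        (cong (wordSum n (F 0) +_) (wordSum-sumTo n k (λ p → F (suc p))))

sumTo-≡-at : ∀ k d {h h′ : ℕ → ℕ} → d < k → (∀ p → p < k → p ≢ d → h p ≡ h′ p) →
             sumTo k h ≡ sumTo k h′ → h d ≡ h′ d
sumTo-≡-at (suc k) zero    d<k others sums =
  +-cancelʳ-≡ _ _ _ (trans sums (cong (_ +_) (sym (sumTo-cong k (λ p p<k → others (suc p) (s<s p<k) λ ())))))
sumTo-≡-at (suc k) (suc d) d<k others sums =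
  sumTo-≡-at k d (s<s⁻¹ d<k) (λ p p<k p≢d → others (suc p) (s<s p<k) (p≢d ∘ suc-injective))
    (+-cancelˡ-≡ _ _ _ (trans sums (cong (_+ _) (sym (others 0 z<s λ ())))))

record AvoidanceRecurrence (m : ℕ) : Set where
  field
    f g c    : ℕ → ℕ
    f-zero   : f 0 ≡ 1
    c-zero   : c 0 ≡ 1
    g-small  : ∀ {k} → k ≤ m → g k ≡ 0
    g-first  : 0 < g (suc m)
    f-suc    : ∀ n → f (suc n) + g (suc n) ≡ f n + f n
    f-double : ∀ n → f n + f n ≡ sumTo (suc m) (λ p → c p * g (suc m ∸ p + n))

  f-double-leading : ∀ n → f n + f n ≡ g (suc m + n) + sumTo m (λ p → c (suc p) * g (m ∸ p + n))
  f-double-leading n =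
    trans (f-double n) (cong (_+ sumTo m (λ p → c (suc p) * g (m ∸ p + n)))
                             (trans (cong (_* g (suc m + n)) c-zero) (*-identityˡ (g (suc m + n)))))

module _ {m : ℕ} (S T : AvoidanceRecurrence m) where
  private
    module S = AvoidanceRecurrence S
    module T = AvoidanceRecurrence T

  g-agree : (∀ n → S.f n ≡ T.f n) → ∀ n → S.g n ≡ T.g n
  g-agree f≗ zero    = trans (S.g-small z≤n) (sym (T.g-small z≤n))
  g-agree f≗ (suc n) = +-cancelˡ-≡ (S.f (suc n)) _ _ (begin
    S.f (suc n) + S.g (suc n) ≡⟨ S.f-suc n ⟩
    S.f n + S.f n             ≡⟨ cong₂ _+_ (f≗ n) (f≗ n) ⟩
    T.f n + T.f n             ≡⟨ T.f-suc n ⟨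
    T.f (suc n) + T.g (suc n) ≡⟨ cong (_+ T.g (suc n)) (f≗ (suc n)) ⟨
    S.f (suc n) + T.g (suc n) ∎)
    where open ≡-Reasoning

  c-agree : (∀ n → S.f n ≡ T.f n) → ∀ p → p ≤ m → S.c p ≡ T.c p
  c-agree f≗ = <-rec (λ d → d ≤ m → S.c d ≡ T.c d) step
    where
      shift-small : ∀ {p d} → p < suc m → d < p → suc m ∸ p + d ≤ m
      shift-small {p} {d} p<1+m d<p =
        ≤-pred (subst (suc m ∸ p + d <_) (m∸n+n≡m (<⇒≤ p<1+m)) (+-monoʳ-< (suc m ∸ p) d<p))

      -- f-double d is triangular in c: the terms p > d vanish because g is 0 below m + 1,
      -- the terms p < d agree by induction, and the term p = d is c d * g (m + 1).
      step : ∀ d → (∀ {p} → p < d → p ≤ m → S.c p ≡ T.c p) → d ≤ m → S.c d ≡ T.c d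
      step d IH d≤m = *-cancelʳ-≡ (S.c d) (T.c d) (S.g (suc m)) {{>-nonZero S.g-first}}
        (subst (λ k → S.c d * S.g k ≡ T.c d * S.g k) (m∸n+n≡m (m≤n⇒m≤1+n d≤m))
               (sumTo-≡-at (suc m) d (s≤s d≤m) others sums))
        where
          open ≡-Reasoning
          term : (ℕ → ℕ) → ℕ → ℕ
          term c p = c p * S.g (suc m ∸ p + d)

          sums : sumTo (suc m) (term S.c) ≡ sumTo (suc m) (term T.c)
          sums = begin
            sumTo (suc m) (term S.c)
              ≡⟨ S.f-double d ⟨
            S.f d + S.f d
              ≡⟨ cong₂ _+_ (f≗ d) (f≗ d) ⟩
            T.f d + T.f d
              ≡⟨ T.f-double d ⟩
            sumTo (suc m) (λ p → T.c p * T.g (suc m ∸ p + d))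
              ≡⟨ sumTo-cong (suc m) (λ p _ → cong (T.c p *_) (g-agree f≗ (suc m ∸ p + d))) ⟨
            sumTo (suc m) (term T.c) ∎

          others : ∀ p → p < suc m → p ≢ d → term S.c p ≡ term T.c p
          others p p<1+m p≢d with <-cmp p d
          ... | tri< p<d _ _ = cong (_* S.g (suc m ∸ p + d)) (IH p<d (≤-trans (<⇒≤ p<d) d≤m))
          ... | tri≈ _ p≡d _ = contradiction p≡d p≢d
          ... | tri> _ _ d<p rewrite S.g-small (shift-small p<1+m d<p) =
            trans (*-zeroʳ (S.c p)) (sym (*-zeroʳ (T.c p)))

  f-agree : (∀ p → p ≤ m → S.c p ≡ T.c p) → ∀ n → S.f n ≡ T.f n
  f-agree c≗ n = proj₁ (<-rec Agree step n)
    where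
      open ≡-Reasoning
      Agree : ℕ → Set
      Agree k = S.f k ≡ T.f k × S.g k ≡ T.g k

      g-beyond : ∀ n → (∀ {k} → k < suc m + n → Agree k) → S.g (suc m + n) ≡ T.g (suc m + n)
      g-beyond n IH = +-cancelʳ-≡ _ _ _ (begin
        S.g (suc m + n) + lower S.c S.g ≡⟨ S.f-double-leading n ⟨
        S.f n + S.f n                   ≡⟨ cong₂ _+_ f-n f-n ⟩
        T.f n + T.f n                   ≡⟨ T.f-double-leading n ⟩
        T.g (suc m + n) + lower T.c T.g ≡⟨ cong (T.g (suc m + n) +_) lower-agree ⟨
        T.g (suc m + n) + lower S.c S.g ∎)
        where
          lower : (ℕ → ℕ) → (ℕ → ℕ) → ℕ
          lower c g = sumTo m (λ p → c (suc p) * g (m ∸ p + n))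
          f-n : S.f n ≡ T.f n
          f-n = proj₁ (IH (s≤s (m≤n+m n m)))
          lower-agree : lower S.c S.g ≡ lower T.c T.g
          lower-agree = sumTo-cong m (λ p p<m →
            cong₂ _*_ (c≗ (suc p) p<m) (proj₂ (IH (s≤s (+-monoˡ-≤ n (m∸n≤m m p))))))

      g-at : ∀ N → (∀ {k} → k < N → Agree k) → S.g N ≡ T.g N
      g-at N IH with N ≤? m
      ... | yes N≤m = trans (S.g-small N≤m) (sym (T.g-small N≤m))
      ... | no N≰m with (n , refl) ← m≤n⇒∃[o]m+o≡n (≰⇒> N≰m) = g-beyond n IH

      f-at : ∀ N → (∀ {k} → k < N → Agree k) → S.g N ≡ T.g N → S.f N ≡ T.f N
      f-at zero    IH _   = trans S.f-zero (sym T.f-zero)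
      f-at (suc n) IH g-N = +-cancelʳ-≡ _ _ _ (begin
        S.f (suc n) + S.g (suc n) ≡⟨ S.f-suc n ⟩
        S.f n + S.f n             ≡⟨ cong₂ _+_ (proj₁ (IH ≤-refl)) (proj₁ (IH ≤-refl)) ⟩
        T.f n + T.f n             ≡⟨ T.f-suc n ⟨
        T.f (suc n) + T.g (suc n) ≡⟨ cong (T.f (suc n) +_) g-N ⟨
        T.f (suc n) + S.g (suc n) ∎)

      step : ∀ N → (∀ {k} → k < N → Agree k) → Agree N
      step N IH = f-at N IH (g-at N IH) , g-at N IH

  f-agree⇔c-agree : (∀ n → S.f n ≡ T.f n) ⇔ (∀ p → p ≤ m → S.c p ≡ T.c p)
  f-agree⇔c-agree = mk⇔ c-agree f-agree

module Avoidance {m : ℕ} (A : List Bool) (∣A∣ : length A ≡ suc m) where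

  occursAtHead : List Bool → Bool
  occursAtHead w = take (suc m) w ==± A

  avoids : List Bool → Bool
  avoids []      = true
  avoids (x ∷ w) = not (occursAtHead (x ∷ w)) ∧ avoids w

  occursOnlyAtHead : List Bool → Bool
  occursOnlyAtHead w = occursAtHead w ∧ avoids (drop 1 w)

  selfOverlap : ℕ → Bool
  selfOverlap p = take (suc m ∸ p) A ==± drop p A

  avoiding : ℕ → ℕ
  avoiding n = wordSum n (𝟙 ∘ avoids)

  leading : ℕ → ℕ
  leading n = wordSum n (𝟙 ∘ occursOnlyAtHead)

  occursAtHead-short : ∀ w → length w ≤ m → occursAtHead w ≡ false
  occursAtHead-short w ∣w∣≤m rewrite take-all (suc m) w (m≤n⇒m≤1+n ∣w∣≤m) =
    cong₂ _∨_ (==-false (length-≢ A ∣A∣)) (==-false (length-≢ (map not A) (trans (length-map not A) ∣A∣)))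
    where
      length-≢ : ∀ X → length X ≡ suc m → w ≢ X
      length-≢ X ∣X∣ w≡X = <⇒≢ (s≤s ∣w∣≤m) (trans (cong length w≡X) ∣X∣)

  occursAtHead⇒long : ∀ w → occursAtHead w ≡ true → suc m ≤ length w
  occursAtHead⇒long w occ with suc m ≤? length w
  ... | yes long = long
  ... | no short = contradiction (trans (sym occ) (occursAtHead-short w (≤-pred (≰⇒> short)))) λ ()

  occursAtHead-self : occursAtHead A ≡ true
  occursAtHead-self rewrite take-all (suc m) A (≤-reflexive ∣A∣) = cong (_∨ (A == map not A)) (==-refl A)

  occursAtHead-++ˡ : ∀ u v → length u ≡ suc m → occursAtHead (u ++ v) ≡ occursAtHead u
  occursAtHead-++ˡ u v ∣u∣ = cong (_==± A) (begin
    take (suc m) (u ++ v)        ≡⟨ cong (λ k → take k (u ++ v)) (trans (sym ∣u∣) (sym (+-identityʳ _))) ⟩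
    take (length u + 0) (u ++ v) ≡⟨ take-++ u v 0 ⟩
    u ++ []                      ≡⟨ ++-identityʳ u ⟩
    u                            ≡⟨ take-all (suc m) u (≤-reflexive ∣u∣) ⟨
    take (suc m) u               ∎)
    where open ≡-Reasoning

  take-occurrence : ∀ k v → k ≤ suc m → occursAtHead v ≡ true →
                    take k v ≡ take k A ⊎ take k v ≡ map not (take k A)
  take-occurrence k v k≤1+m occ =
    Sum.map (λ e → trans prefix (cong (take k) e)) (λ e → trans prefix (trans (cong (take k) e) (take-map k A)))
            (to T-==± (from T-≡ occ))
    where
      prefix : take k v ≡ take k (take (suc m) v)
      prefix = sym (trans (take-take k (suc m) v) (cong (λ j → take j v) (m≤n⇒m⊓n≡m k≤1+m)))

  avoids-short : ∀ w → length w ≤ m → avoids w ≡ true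
  avoids-short []      _     = refl
  avoids-short (x ∷ w) ∣w∣≤m rewrite occursAtHead-short (x ∷ w) ∣w∣≤m =
    avoids-short w (≤-trans (n≤1+n _) ∣w∣≤m)

  avoids-unfold : ∀ w → avoids w ≡ not (occursAtHead w) ∧ avoids (drop 1 w)
  avoids-unfold []      rewrite occursAtHead-short [] z≤n = refl
  avoids-unfold (x ∷ w) = refl

  avoids-drop1 : ∀ w → 𝟙 (avoids (drop 1 w)) ≡ 𝟙 (avoids w) + 𝟙 (occursOnlyAtHead w)
  avoids-drop1 w = trans (𝟙-split (occursAtHead w) (avoids (drop 1 w)))
                         (cong (λ b → 𝟙 b + 𝟙 (occursOnlyAtHead w)) (sym (avoids-unfold w)))

  avoids-drop : ∀ k w →
                𝟙 (avoids (drop k w)) ≡ 𝟙 (avoids w) + sumTo k (λ p → 𝟙 (occursOnlyAtHead (drop p w)))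
  avoids-drop zero    w = sym (+-identityʳ _)
  avoids-drop (suc k) w = begin
    𝟙 (avoids (drop (suc k) w))
      ≡⟨ cong (𝟙 ∘ avoids) (drop-drop 1 k w) ⟨
    𝟙 (avoids (drop k (drop 1 w)))
      ≡⟨ avoids-drop k (drop 1 w) ⟩
    𝟙 (avoids (drop 1 w)) + sumTo k (λ p → 𝟙 (occursOnlyAtHead (drop p (drop 1 w))))
      ≡⟨ cong₂ _+_ (avoids-drop1 w) (sumTo-cong k (λ p _ → cong (𝟙 ∘ occursOnlyAtHead) (drop-drop 1 p w))) ⟩
    𝟙 (avoids w) + 𝟙 (occursOnlyAtHead w) + sumTo k (λ p → 𝟙 (occursOnlyAtHead (drop (suc p) w)))
      ≡⟨ +-assoc (𝟙 (avoids w)) _ _ ⟩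
    𝟙 (avoids w) + sumTo (suc k) (λ p → 𝟙 (occursOnlyAtHead (drop p w))) ∎
    where open ≡-Reasoning

  occursAtHead*avoids : ∀ z → 𝟙 (occursAtHead z) * 𝟙 (avoids z) ≡ 0
  occursAtHead*avoids z rewrite avoids-unfold z with occursAtHead z
  ... | true  = refl
  ... | false = refl

  last-occurrence : ∀ z → 𝟙 (occursAtHead z) * 𝟙 (avoids (drop (suc m) z))
                        ≡ sumTo (suc m) (λ p → 𝟙 (occursAtHead z) * 𝟙 (occursOnlyAtHead (drop p z)))
  last-occurrence z = begin
    o * 𝟙 (avoids (drop (suc m) z))  ≡⟨ cong (o *_) (avoids-drop (suc m) z) ⟩
    o * (𝟙 (avoids z) + later)       ≡⟨ *-distribˡ-+ o _ later ⟩
    o * 𝟙 (avoids z) + o * later     ≡⟨ cong (_+ o * later) (occursAtHead*avoids z) ⟩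
    o * later                        ≡⟨ sumTo-*ˡ (suc m) o (λ p → 𝟙 (occursOnlyAtHead (drop p z))) ⟩
    sumTo (suc m) (λ p → o * 𝟙 (occursOnlyAtHead (drop p z))) ∎
    where
      open ≡-Reasoning
      o later : ℕ
      o = 𝟙 (occursAtHead z)
      later = sumTo (suc m) (λ p → 𝟙 (occursOnlyAtHead (drop p z)))

  occurrences : wordSum (suc m) (𝟙 ∘ occursAtHead) ≡ 2
  occurrences = begin
    wordSum (suc m) (𝟙 ∘ occursAtHead)
      ≡⟨ wordSum-cong (suc m) (λ u ∣u∣ →
           cong (λ w → 𝟙 (w ==± A)) (take-all (suc m) u (≤-reflexive ∣u∣))) ⟩
    wordSum (suc m) (λ u → 𝟙 (u ==± A))
      ≡⟨ wordSum-cong (suc m) (λ u _ → 𝟙-==± u A A≢[]) ⟩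
    wordSum (suc m) (λ u → 𝟙 (u == A) + 𝟙 (u == map not A))
      ≡⟨ wordSum-+ (suc m) (λ u → 𝟙 (u == A)) (λ u → 𝟙 (u == map not A)) ⟩
    wordSum (suc m) (λ u → 𝟙 (u == A)) + wordSum (suc m) (λ u → 𝟙 (u == map not A))
      ≡⟨ cong₂ _+_ (wordSum-== (suc m) A ∣A∣)
                   (wordSum-== (suc m) (map not A) (trans (length-map not A) ∣A∣)) ⟩
    2 ∎
    where
      open ≡-Reasoning
      A≢[] : 1 ≤ length A
      A≢[] = subst (1 ≤_) (sym ∣A∣) (s≤s z≤n)

  shifted-occurrences : ∀ p v → p ≤ m → occursAtHead v ≡ true →
                        wordSum p (λ u → 𝟙 (occursAtHead (u ++ v))) ≡ 𝟙 (selfOverlap p)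
  shifted-occurrences p v p≤m occ = begin
    wordSum p (λ u → 𝟙 (occursAtHead (u ++ v)))
      ≡⟨ wordSum-cong p (λ u ∣u∣ → cong (λ w → 𝟙 (w ==± A)) (head-of-++ u ∣u∣)) ⟩
    wordSum p (λ u → 𝟙 ((u ++ t) ==± A))
      ≡⟨ wordSum-prefix-==± p t A (trans ∣A∣ (trans (sym p+i) (cong (p +_) (sym ∣t∣)))) t≢[] ⟩
    𝟙 (t ==± drop p A)
      ≡⟨ cong 𝟙 (head-of-overlap (take-occurrence i v (m∸n≤m (suc m) p) occ)) ⟩
    𝟙 (selfOverlap p) ∎
    where
      open ≡-Reasoning
      i : ℕ
      i = suc m ∸ p
      t : List Bool
      t = take i v
      p+i : p + i ≡ suc m
      p+i = m+[n∸m]≡n (m≤n⇒m≤1+n p≤m)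
      ∣t∣ : length t ≡ i
      ∣t∣ = trans (length-take i v) (m≤n⇒m⊓n≡m (≤-trans (m∸n≤m (suc m) p) (occursAtHead⇒long v occ)))
      t≢[] : 1 ≤ length t
      t≢[] = subst (1 ≤_) (sym (trans ∣t∣ (+-∸-assoc 1 p≤m))) (s≤s z≤n)
      head-of-++ : ∀ u → length u ≡ p → take (suc m) (u ++ v) ≡ u ++ t
      head-of-++ u ∣u∣ = trans (cong (λ k → take k (u ++ v)) (trans (sym p+i) (cong (_+ i) (sym ∣u∣))))
                               (take-++ u v i)
      head-of-overlap : t ≡ take i A ⊎ t ≡ map not (take i A) → (t ==± drop p A) ≡ selfOverlap p
      head-of-overlap (inj₁ t≡) = cong (_==± drop p A) t≡
      head-of-overlap (inj₂ t≡) = trans (cong (_==± drop p A) t≡) (==±-map-notˡ (take i A) (drop p A))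

  avoiding-double-as-sum : ∀ n → wordSum (suc m + n) (λ z → 𝟙 (occursAtHead z) * 𝟙 (avoids (drop (suc m) z)))
                                 ≡ avoiding n + avoiding n
  avoiding-double-as-sum n = begin
    wordSum (suc m + n) (λ z → 𝟙 (occursAtHead z) * 𝟙 (avoids (drop (suc m) z)))
      ≡⟨ wordSum-++ (suc m) n (λ z → 𝟙 (occursAtHead z) * 𝟙 (avoids (drop (suc m) z))) ⟩
    wordSum (suc m) (λ u → wordSum n (λ v → 𝟙 (occursAtHead (u ++ v)) * 𝟙 (avoids (drop (suc m) (u ++ v)))))
      ≡⟨ wordSum-cong (suc m) (λ u ∣u∣ → trans (wordSum-cong n (λ v _ → split u v ∣u∣))
                                               (wordSum-*ˡ n (𝟙 (occursAtHead u)) (𝟙 ∘ avoids))) ⟩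
    wordSum (suc m) (λ u → 𝟙 (occursAtHead u) * avoiding n)
      ≡⟨ wordSum-*ʳ (suc m) (avoiding n) (𝟙 ∘ occursAtHead) ⟩
    wordSum (suc m) (𝟙 ∘ occursAtHead) * avoiding n
      ≡⟨ cong (_* avoiding n) occurrences ⟩
    2 * avoiding n
      ≡⟨ cong (avoiding n +_) (+-identityʳ (avoiding n)) ⟩
    avoiding n + avoiding n ∎
    where
      open ≡-Reasoning
      split : ∀ u v → length u ≡ suc m →
              𝟙 (occursAtHead (u ++ v)) * 𝟙 (avoids (drop (suc m) (u ++ v))) ≡ 𝟙 (occursAtHead u) * 𝟙 (avoids v)
      split u v ∣u∣ = cong₂ (λ b w → 𝟙 b * 𝟙 (avoids w)) (occursAtHead-++ˡ u v ∣u∣)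
                            (trans (cong (λ k → drop k (u ++ v)) (sym ∣u∣)) (drop-++ u v))

  occurrence-then-lead : ∀ n p → p ≤ m →
    wordSum (suc m + n) (λ z → 𝟙 (occursAtHead z) * 𝟙 (occursOnlyAtHead (drop p z)))
      ≡ 𝟙 (selfOverlap p) * leading (suc m ∸ p + n)
  occurrence-then-lead n p p≤m = begin
    wordSum (suc m + n) H
      ≡⟨ cong (λ N → wordSum N H) 1+m+n≡p+q ⟩
    wordSum (p + q) H
      ≡⟨ wordSum-++ p q H ⟩
    wordSum p (λ u → wordSum q (λ v → H (u ++ v)))
      ≡⟨ wordSum-cong p (λ u ∣u∣ → wordSum-cong q (λ v _ →
           cong (λ w → 𝟙 (occursAtHead (u ++ v)) * 𝟙 (occursOnlyAtHead w))
                (trans (cong (λ k → drop k (u ++ v)) (sym ∣u∣)) (drop-++ u v)))) ⟩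
    wordSum p (λ u → wordSum q (λ v → 𝟙 (occursAtHead (u ++ v)) * 𝟙 (occursOnlyAtHead v)))
      ≡⟨ wordSum-comm p q (λ u v → 𝟙 (occursAtHead (u ++ v)) * 𝟙 (occursOnlyAtHead v)) ⟩
    wordSum q (λ v → wordSum p (λ u → 𝟙 (occursAtHead (u ++ v)) * 𝟙 (occursOnlyAtHead v)))
      ≡⟨ wordSum-cong q (λ v _ →
           trans (wordSum-*ʳ p (𝟙 (occursOnlyAtHead v)) (λ u → 𝟙 (occursAtHead (u ++ v))))
                 (𝟙-guard (occursOnlyAtHead v) (shifted-occurrences p v p≤m ∘ ∧-conicalˡ _ _))) ⟩
    wordSum q (λ v → 𝟙 (selfOverlap p) * 𝟙 (occursOnlyAtHead v))
      ≡⟨ wordSum-*ˡ q (𝟙 (selfOverlap p)) (𝟙 ∘ occursOnlyAtHead) ⟩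
    𝟙 (selfOverlap p) * leading q ∎
    where
      open ≡-Reasoning
      H : List Bool → ℕ
      H z = 𝟙 (occursAtHead z) * 𝟙 (occursOnlyAtHead (drop p z))
      q : ℕ
      q = suc m ∸ p + n
      1+m+n≡p+q : suc m + n ≡ p + q
      1+m+n≡p+q = trans (cong (_+ n) (sym (m+[n∸m]≡n (m≤n⇒m≤1+n p≤m)))) (+-assoc p (suc m ∸ p) n)

  avoiding-suc : ∀ n → avoiding (suc n) + leading (suc n) ≡ avoiding n + avoiding n
  avoiding-suc n = trans (sym (wordSum-+ (suc n) (𝟙 ∘ avoids) (𝟙 ∘ occursOnlyAtHead)))
                         (sym (wordSum-cong (suc n) (λ w _ → avoids-drop1 w)))

  avoiding-double : ∀ n →
                    avoiding n + avoiding n ≡ sumTo (suc m) (λ p → 𝟙 (selfOverlap p) * leading (suc m ∸ p + n))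
  avoiding-double n = begin
    avoiding n + avoiding n
      ≡⟨ avoiding-double-as-sum n ⟨
    wordSum (suc m + n) (λ z → 𝟙 (occursAtHead z) * 𝟙 (avoids (drop (suc m) z)))
      ≡⟨ wordSum-cong (suc m + n) (λ z _ → last-occurrence z) ⟩
    wordSum (suc m + n) (λ z → sumTo (suc m) (λ p → 𝟙 (occursAtHead z) * 𝟙 (occursOnlyAtHead (drop p z))))
      ≡⟨ wordSum-sumTo (suc m + n) (suc m) (λ p z → 𝟙 (occursAtHead z) * 𝟙 (occursOnlyAtHead (drop p z))) ⟩
    sumTo (suc m) (λ p → wordSum (suc m + n) (λ z → 𝟙 (occursAtHead z) * 𝟙 (occursOnlyAtHead (drop p z))))
      ≡⟨ sumTo-cong (suc m) (λ p p<1+m → occurrence-then-lead n p (≤-pred p<1+m)) ⟩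
    sumTo (suc m) (λ p → 𝟙 (selfOverlap p) * leading (suc m ∸ p + n)) ∎
    where open ≡-Reasoning

  leading-small : ∀ {k} → k ≤ m → leading k ≡ 0
  leading-small {k} k≤m = trans (wordSum-cong k (λ w ∣w∣ → cong (λ b → 𝟙 (b ∧ avoids (drop 1 w)))
                                   (occursAtHead-short w (≤-trans (≤-reflexive ∣w∣) k≤m))))
                                (wordSum-zero k)

  leading-first : 0 < leading (suc m)
  leading-first = subst (λ N → 1 ≤ wordSum N (𝟙 ∘ occursOnlyAtHead)) ∣A∣
                        (subst (_≤ wordSum (length A) (𝟙 ∘ occursOnlyAtHead)) (cong 𝟙 A-leads)
                               (wordSum-≥ A (𝟙 ∘ occursOnlyAtHead)))
    where
      A-leads : occursOnlyAtHead A ≡ true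
      A-leads = cong₂ _∧_ occursAtHead-self
                          (avoids-short (drop 1 A) (≤-reflexive (trans (length-drop 1 A) (cong (_∸ 1) ∣A∣))))

  recurrence : AvoidanceRecurrence m
  recurrence = record
    { f        = avoiding
    ; g        = leading
    ; c        = 𝟙 ∘ selfOverlap
    ; f-zero   = refl
    ; c-zero   = cong 𝟙 occursAtHead-self
    ; g-small  = leading-small
    ; g-first  = leading-first
    ; f-suc    = avoiding-suc
    ; f-double = avoiding-double
    }

Star-fixed : ∀ {X : Set} {R : X → X → Set} {u} → (∀ {w} → R u w → w ≡ u) → ∀ {v} → Star R u v → v ≡ u
Star-fixed back ε = refl
Star-fixed back (step ◅ rest) with refl ← back step = Star-fixed back rest

flipRange-moves : ∀ {n} i k (u : Vec Bool n) → i < n → flipRange i (suc k) u ≢ u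
flipRange-moves {n} i k u i<n flip≡u = not-¬ refl (sym flipped)
  where
    open ≡-Reasoning
    j : Fin n
    j = fromℕ< i<n
    in-range : (i ≤ᵇ toℕ j) ∧ (toℕ j <ᵇ i + suc k) ≡ true
    in-range rewrite toℕ-fromℕ< i<n =
      cong₂ _∧_ (to T-≡ (≤⇒≤ᵇ (≤-refl {i}))) (to T-≡ (<⇒<ᵇ (m<m+n i z<s)))
    flipped : not (lookup u j) ≡ lookup u j
    flipped = begin
      not (lookup u j)
        ≡⟨ cong (λ b → if b then not (lookup u j) else lookup u j) in-range ⟨
      (if (i ≤ᵇ toℕ j) ∧ (toℕ j <ᵇ i + suc k) then not (lookup u j) else lookup u j)
        ≡⟨ lookup∘tabulate _ j ⟨
      lookup (flipRange i (suc k) u) j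
        ≡⟨ cong (λ v → lookup v j) flip≡u ⟩
      lookup u j ∎

allWords : ∀ n → List (Vec Bool n)
allWords zero    = []ᵛ ∷ []
allWords (suc n) = map (false ∷ᵛ_) (allWords n) ++ map (true ∷ᵛ_) (allWords n)

∈-allWords : ∀ {n} (u : Vec Bool n) → u ∈ allWords n
∈-allWords []ᵛ          = here refl
∈-allWords (false ∷ᵛ u) = ∈-++⁺ˡ (∈-map⁺ (false ∷ᵛ_) (∈-allWords u))
∈-allWords (true  ∷ᵛ u) = ∈-++⁺ʳ (map (false ∷ᵛ_) (allWords _)) (∈-map⁺ (true ∷ᵛ_) (∈-allWords u))

allWords-unique : ∀ n → Unique (allWords n)
allWords-unique zero    = [] ∷ []
allWords-unique (suc n) =
  Unique.++⁺ (Unique.map⁺ Vec.∷-injectiveʳ (allWords-unique n))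
             (Unique.map⁺ Vec.∷-injectiveʳ (allWords-unique n))
             disjoint
  where
    disjoint : ∀ {v} → ¬ (v ∈ map (false ∷ᵛ_) (allWords n) × v ∈ map (true ∷ᵛ_) (allWords n))
    disjoint (v∈₀ , v∈₁) with ∈-map⁻ (false ∷ᵛ_) v∈₀ | ∈-map⁻ (true ∷ᵛ_) v∈₁
    ... | _ , _ , refl | _ , _ , ()

sum-allWords : ∀ n (h : List Bool → ℕ) → sum (map (h ∘ toList) (allWords n)) ≡ wordSum n h
sum-allWords zero    h = +-identityʳ (h [])
sum-allWords (suc n) h = begin
  sum (map F (map (false ∷ᵛ_) W ++ map (true ∷ᵛ_) W))
    ≡⟨ cong sum (map-++ F (map (false ∷ᵛ_) W) (map (true ∷ᵛ_) W)) ⟩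
  sum (map F (map (false ∷ᵛ_) W) ++ map F (map (true ∷ᵛ_) W))
    ≡⟨ sum-++ (map F (map (false ∷ᵛ_) W)) (map F (map (true ∷ᵛ_) W)) ⟩
  sum (map F (map (false ∷ᵛ_) W)) + sum (map F (map (true ∷ᵛ_) W))
    ≡⟨ cong₂ _+_ (cong sum (map-∘ W)) (cong sum (map-∘ W)) ⟨
  sum (map (λ u → h (false ∷ toList u)) W) + sum (map (λ u → h (true ∷ toList u)) W)
    ≡⟨ cong₂ _+_ (sum-allWords n (λ w → h (false ∷ w))) (sum-allWords n (λ w → h (true ∷ w))) ⟩
  wordSum (suc n) h ∎
  where
    open ≡-Reasoning
    F : Vec Bool (suc n) → ℕ
    F = h ∘ toList
    W : List (Vec Bool n)
    W = allWords n

length-filter≡sum : ∀ {X : Set} (g : X → Bool) xs →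
                    length (filter (λ x → g x ≟ᵇ true) xs) ≡ sum (map (𝟙 ∘ g) xs)
length-filter≡sum g []       = refl
length-filter≡sum g (x ∷ xs) with g x
... | true  = cong suc (length-filter≡sum g xs)
... | false = length-filter≡sum g xs

unique-length : ∀ {X : Set} {xs ys : List X} → Unique xs → Unique ys → (∀ {x} → (x ∈ xs) ⇔ (x ∈ ys)) →
                length xs ≡ length ys
unique-length xs! ys! xs⇔ys = ↭-length (∼bag⇒↭ (unique∧set⇒bag xs! ys! xs⇔ys))

module Singletons {m : ℕ} (a : Vec Bool (suc m)) where
  open Avoidance (toList a) (length-toList a) public

  -- The test in  φ a (suc i) u  unfolds to  (suc i + m ≤ᵇ n) ∧ occursAtHead (drop i (toList u)).
  φ-fixes : ∀ {n} i (u : Vec Bool n) → occursAtHead (drop i (toList u)) ≡ false → φ a (suc i) u ≡ u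
  φ-fixes {n} i u occ =
    cong (λ b → if b then flipRange i (suc m) u else u) (trans (cong ((suc i + m ≤ᵇ n) ∧_) occ) (∧-zeroʳ _))

  occurrence-room : ∀ {n} i (u : Vec Bool n) → occursAtHead (drop i (toList u)) ≡ true → suc m ≤ n ∸ i
  occurrence-room {n} i u occ = subst (suc m ≤_) (trans (length-drop i (toList u)) (cong (_∸ i) (length-toList u)))
                                      (occursAtHead⇒long (drop i (toList u)) occ)

  occurrence-start : ∀ {n} i (u : Vec Bool n) → occursAtHead (drop i (toList u)) ≡ true → i < n
  occurrence-start i u occ = m∸n≢0⇒n<m (m<n⇒n≢0 (occurrence-room i u occ))

  φ-flips : ∀ {n} i (u : Vec Bool n) → occursAtHead (drop i (toList u)) ≡ true →
            φ a (suc i) u ≡ flipRange i (suc m) u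
  φ-flips {n} i u occ =
    cong (λ b → if b then flipRange i (suc m) u else u) (cong₂ _∧_ (to T-≡ (≤⇒≤ᵇ fits)) occ)
    where
      fits : suc i + m ≤ n
      fits = subst (_≤ n) (cong suc (+-comm m i))
                   (m≤o∸n⇒m+n≤o (suc m) (<⇒≤ (occurrence-start i u occ)) (occurrence-room i u occ))

  avoids⇒no-occurrence : ∀ w → avoids w ≡ true → ∀ i → occursAtHead (drop i w) ≡ false
  avoids⇒no-occurrence []      _      zero    = occursAtHead-short [] z≤n
  avoids⇒no-occurrence []      _      (suc i) = occursAtHead-short [] z≤n
  avoids⇒no-occurrence (x ∷ w) x∷w-avoids zero    =
    trans (sym (not-involutive _)) (cong not (∧-conicalˡ _ (avoids w) x∷w-avoids))
  avoids⇒no-occurrence (x ∷ w) x∷w-avoids (suc i) =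
    avoids⇒no-occurrence w (∧-conicalʳ (not (occursAtHead (x ∷ w))) _ x∷w-avoids) i

  no-occurrence⇒avoids : ∀ w → (∀ i → occursAtHead (drop i w) ≡ false) → avoids w ≡ true
  no-occurrence⇒avoids []      _    = refl
  no-occurrence⇒avoids (x ∷ w) none rewrite none 0 = no-occurrence⇒avoids w (none ∘ suc)

  singleton⇔avoids : ∀ {n} (u : Vec Bool n) → SingletonClass a u ⇔ avoids (toList u) ≡ true
  singleton⇔avoids {n} u = mk⇔ singleton⇒avoids avoids⇒singleton
    where
      singleton⇒avoids : SingletonClass a u → avoids (toList u) ≡ true
      singleton⇒avoids single = no-occurrence⇒avoids (toList u) none
        where
          none : ∀ i → occursAtHead (drop i (toList u)) ≡ false
          none i with occursAtHead (drop i (toList u)) in occ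
          ... | false = refl
          ... | true  = contradiction (single _ ((suc i , s≤s z≤n , occurrence-start i u occ , refl) ◅ ε))
                                      (flipRange-moves i m u (occurrence-start i u occ) ∘ trans (sym (φ-flips i u occ)))

      avoids⇒singleton : avoids (toList u) ≡ true → SingletonClass a u
      avoids⇒singleton u-avoids _ = Star-fixed λ { (i , _ , _ , φu≡w) → trans (sym φu≡w) (φ-fixed i) }
        where
          φ-fixed : ∀ i → φ a i u ≡ u
          φ-fixed zero    = refl
          φ-fixed (suc i) = φ-fixes i u (avoids⇒no-occurrence (toList u) u-avoids i)

  avoids? : ∀ {n} (u : Vec Bool n) → Dec (avoids (toList u) ≡ true)
  avoids? u = avoids (toList u) ≟ᵇ true

  singletons : ∀ n → List (Vec Bool n)
  singletons n = filter avoids? (allWords n)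

  ∈-singletons : ∀ {n} (u : Vec Bool n) → u ∈ singletons n ⇔ SingletonClass a u
  ∈-singletons {n} u = mk⇔ (from (singleton⇔avoids u) ∘ proj₂ ∘ ∈-filter⁻ avoids? {xs = allWords n})
                           (∈-filter⁺ avoids? (∈-allWords u) ∘ to (singleton⇔avoids u))

  length-singletons : ∀ n → length (singletons n) ≡ avoiding n
  length-singletons n = trans (length-filter≡sum (avoids ∘ toList) (allWords n)) (sum-allWords n (𝟙 ∘ avoids))

  singletonClassCount⇔ : ∀ n k → SingletonClassCount a n k ⇔ avoiding n ≡ k
  singletonClassCount⇔ n k = mk⇔ count⇒ count⇐
    where
      singletons! : Unique (singletons n)
      singletons! = Unique.filter⁺ avoids? (allWords-unique n)
      count⇒ : SingletonClassCount a n k → avoiding n ≡ k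
      count⇒ (xs , xs! , ∈xs , ∣xs∣) = begin
        avoiding n            ≡⟨ length-singletons n ⟨
        length (singletons n) ≡⟨ unique-length singletons! xs! (λ {u} → mk⇔ (from (∈xs u) ∘ to (∈-singletons u))
                                                                             (from (∈-singletons u) ∘ to (∈xs u))) ⟩
        length xs             ≡⟨ ∣xs∣ ⟩
        k                     ∎
        where open ≡-Reasoning
      count⇐ : avoiding n ≡ k → SingletonClassCount a n k
      count⇐ ∣s∣ = singletons n , singletons! , ∈-singletons , trans (length-singletons n) ∣s∣

  border⇔selfOverlap : ∀ i → i ≤ suc m → Border a i ⇔ T (selfOverlap (suc m ∸ i))
  border⇔selfOverlap i i≤1+m =
    subst (λ k → Border a i ⇔ T (take k (toList a) ==± drop (suc m ∸ i) (toList a))) (sym (m∸[m∸n]≡n i≤1+m))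
          (⇔-sym T-==±)

counts-agree⇔avoiding-agree : ∀ {m} (a b : Vec Bool (suc m)) →
  (∀ n → 1 ≤ n → ∀ k → SingletonClassCount a n k ⇔ SingletonClassCount b n k)
    ⇔ (∀ n → Singletons.avoiding a n ≡ Singletons.avoiding b n)
counts-agree⇔avoiding-agree a b = mk⇔ counts⇒ counts⇐
  where
    module A = Singletons a
    module B = Singletons b

    counts⇒ : (∀ n → 1 ≤ n → ∀ k → SingletonClassCount a n k ⇔ SingletonClassCount b n k) →
              ∀ n → A.avoiding n ≡ B.avoiding n
    counts⇒ counts zero    = refl
    counts⇒ counts (suc n) =
      sym (to (B.singletonClassCount⇔ (suc n) _)
              (to (counts (suc n) (s≤s z≤n) _) (from (A.singletonClassCount⇔ (suc n) _) refl)))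

    counts⇐ : (∀ n → A.avoiding n ≡ B.avoiding n) →
              ∀ n → 1 ≤ n → ∀ k → SingletonClassCount a n k ⇔ SingletonClassCount b n k
    counts⇐ avoiding≗ n _ k =
      mk⇔ (from (B.singletonClassCount⇔ n k) ∘ trans (sym (avoiding≗ n)) ∘ to (A.singletonClassCount⇔ n k))
          (from (A.singletonClassCount⇔ n k) ∘ trans (avoiding≗ n) ∘ to (B.singletonClassCount⇔ n k))

selfOverlaps-agree⇔borders-agree : ∀ {m} (a b : Vec Bool (suc m)) →
  (∀ p → p ≤ m → 𝟙 (Singletons.selfOverlap a p) ≡ 𝟙 (Singletons.selfOverlap b p))
    ⇔ (∀ i → 1 ≤ i → i ≤ suc m → Border a i ⇔ Border b i)
selfOverlaps-agree⇔borders-agree {m} a b = mk⇔ overlaps⇒ overlaps⇐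
  where
    module A = Singletons a
    module B = Singletons b

    borders⇔ : ∀ i → i ≤ suc m →
               (Border a i ⇔ Border b i) ⇔ (𝟙 (A.selfOverlap (suc m ∸ i)) ≡ 𝟙 (B.selfOverlap (suc m ∸ i)))
    borders⇔ i i≤1+m = 𝟙-≡⇔ _ _ (A.border⇔selfOverlap i i≤1+m) (B.border⇔selfOverlap i i≤1+m)

    overlaps⇒ : (∀ p → p ≤ m → 𝟙 (A.selfOverlap p) ≡ 𝟙 (B.selfOverlap p)) →
                ∀ i → 1 ≤ i → i ≤ suc m → Border a i ⇔ Border b i
    overlaps⇒ overlaps i 1≤i i≤1+m =
      from (borders⇔ i i≤1+m) (overlaps (suc m ∸ i) (∸-monoʳ-≤ (suc m) 1≤i))

    overlaps⇐ : (∀ i → 1 ≤ i → i ≤ suc m → Border a i ⇔ Border b i) →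
                ∀ p → p ≤ m → 𝟙 (A.selfOverlap p) ≡ 𝟙 (B.selfOverlap p)
    overlaps⇐ borders p p≤m =
      subst (λ k → 𝟙 (A.selfOverlap k) ≡ 𝟙 (B.selfOverlap k)) (m∸[m∸n]≡n (m≤n⇒m≤1+n p≤m))
            (to (borders⇔ (suc m ∸ p) (m∸n≤m (suc m) p)) (borders (suc m ∸ p) 1≤1+m∸p (m∸n≤m (suc m) p)))
      where
        1≤1+m∸p : 1 ≤ suc m ∸ p
        1≤1+m∸p = subst (1 ≤_) (sym (+-∸-assoc 1 p≤m)) (s≤s z≤n)

proposition3p1 : (m : ℕ) → 1 ≤ m → (a b : Vec Bool (suc m)) →
    ((∀ n → 1 ≤ n → ∀ k → SingletonClassCount a n k ⇔ SingletonClassCount b n k)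
    ⇔ (∀ i → 1 ≤ i → i ≤ suc m → Border a i ⇔ Border b i))
proposition3p1 m _ a b = begin
  (∀ n → 1 ≤ n → ∀ k → SingletonClassCount a n k ⇔ SingletonClassCount b n k)
    ≈⟨ counts-agree⇔avoiding-agree a b ⟩
  (∀ n → A.avoiding n ≡ B.avoiding n)
    ≈⟨ f-agree⇔c-agree A.recurrence B.recurrence ⟩
  (∀ p → p ≤ m → 𝟙 (A.selfOverlap p) ≡ 𝟙 (B.selfOverlap p))
    ≈⟨ selfOverlaps-agree⇔borders-agree a b ⟩
  (∀ i → 1 ≤ i → i ≤ suc m → Border a i ⇔ Border b i) ∎
  where
    open SetoidReasoning (⇔-setoid 0ℓ)
    module A = Singletons a
    module B = Singletons b
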